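{- Consider any non-adaptive interactive protocol in which Alice sends $A$ bits and Bob sends $B$ bits in total, and in which Alice holds an input from some set of possible inputs. For any three possible inputs $x_1,x_2,x_3$, there exist two of them $y_1,y_2\in\{x_1,x_2,x_3\}$ and a transcript $T\in\{0,1\}^{A+B}$ such that, both when Alice has input $y_1$ and when Alice has input $y_2$, an adversary can flip at most $\frac13 A+1$ bits so that the protocol transcript is $T$.
   Context: A non-adaptive interactive protocol has a fixed length and fixed order of speaking: in each round a predetermined party sends one bit. Alice's bits are determined by her input and the bits she has received from Bob so far; Bob's bits are determined by the bits he has received from Alice so far. An adversary may flip any communicated bits (in either direction) online; the transcript is the sequence of bits as received by the parties, and the cost is the number of flipped bits. -}

module Defs where

open import Data.Nat using (ℕ; zero; suc; _+_; _*_; _≤_)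
open import Data.Bool using (Bool; true; false; if_then_else_)
open import Data.Bool.Properties using (_≟_)
open import Data.List using (List; []; _∷_; _++_; [_])
open import Data.Vec using (Vec; []; _∷_)
open import Data.Product using (Σ; _×_; ∃-syntax)
open import Relation.Nullary.Decidable using (does)

data Party : Set where
  alice bob : Party

-- A non-adaptive protocol with n rounds where Alice has inputs from X.
-- order     : the fixed speaking order (round r is spoken by order[r]).
-- aliceMsg x r h : Alice's bit in round r, given her input x and the list h
--                  of bits she has received from Bob so far (in order).
-- bobMsg r h     : Bob's bit in round r, given the list h of bits he has
--                  received from Alice so far (in order).
-- Rounds are indexed by ℕ starting at 0.
record Protocol (X : Set) (n : ℕ) : Set where
  field
    order    : Vec Party n
    aliceMsg : X → ℕ → List Bool → Bool
    bobMsg   : ℕ → List Bool → Bool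

open Protocol public

count : Party → ∀ {m} → Vec Party m → ℕ
count p [] = zero
count alice (alice ∷ o) = suc (count alice o)
count alice (bob ∷ o) = count alice o
count bob (alice ∷ o) = count bob o
count bob (bob ∷ o) = suc (count bob o)

bitsA : {X : Set} {n : ℕ} → Protocol X n → ℕ
bitsA P = count alice (order P)

bitsB : {X : Set} {n : ℕ} → Protocol X n → ℕ
bitsB P = count bob (order P)

mismatch : Bool → Bool → ℕ
mismatch s t = if does (s ≟ t) then zero else suc zero

-- Walk through the rounds: r is the current round index, hA are the bits
-- Alice has received (from Bob) so far, hB those Bob has received (from
-- Alice) so far, as dictated by the received transcript.
costFrom : {X : Set} → (X → ℕ → List Bool → Bool) → (ℕ → List Bool → Bool) →
           X → ℕ → List Bool → List Bool → ∀ {m} → Vec Party m → Vec Bool m → ℕ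
costFrom aM bM x r hA hB [] [] = zero
costFrom aM bM x r hA hB (alice ∷ o) (t ∷ T) =
  mismatch (aM x r hA) t + costFrom aM bM x (suc r) hA (hB ++ [ t ]) o T
costFrom aM bM x r hA hB (bob ∷ o) (t ∷ T) =
  mismatch (bM r hB) t + costFrom aM bM x (suc r) (hA ++ [ t ]) hB o T

-- The number of bits the adversary must flip (online) so that, when Alice
-- has input x, the transcript (bits as received) equals T. Since each sent
-- bit is determined by the input and the received prefix of T, this cost is
-- exactly the number of rounds where the sent bit differs from T.
cost : {X : Set} {n : ℕ} → Protocol X n → X → Vec Bool n → ℕ
cost P x T = costFrom (aliceMsg P) (bobMsg P) x 0 [] [] (order P) T

-- There is a transcript T reachable from both inputs y₁ and y₂ with at most
-- A/3 + 1 flips each (3·cost ≤ A + 3 ⇔ cost ≤ A/3 + 1).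
CommonTranscript : {X : Set} {n : ℕ} → Protocol X n → X → X → Set
CommonTranscript {n = n} P y₁ y₂ =
  ∃[ T ] ((3 * cost P y₁ T ≤ bitsA P + 3) × (3 * cost P y₂ T ≤ bitsA P + 3))

-- Run the three executions side by side on one transcript, sending for each of
-- Alice's rounds the majority of her three bits, so that each round costs at most one
-- flip in total.  With per-input budgets ⌊A/3⌋ + 1 the total budget exceeds A, so by
-- the time some input has exhausted its budget the other two together still have at
-- least as much budget as Alice has rounds left; from then on only those two are
-- followed, and whenever their bits differ the one with budget left is flipped.
module Submission where

open import Defs
open import Data.Nat using (ℕ; NonZero; zero; suc; _+_; _*_; _/_; _%_; _≤_; _<_; z≤n)
open import Data.Nat.Properties
  using (≤-refl; ≤-trans; ≤-reflexive; ≤-pred; <⇒≤; +-mono-≤; +-monoʳ-≤; +-monoˡ-<; +-suc; +-identityʳ;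
         +-comm; *-comm; *-monoʳ-≤; module ≤-Reasoning)
open import Data.Nat.DivMod using (m≡m%n+[m/n]*n; m%n<n; m/n*n≤m)
open import Data.Nat.Tactic.RingSolver using (solve-∀)
open import Data.Bool using (Bool; true; false)
open import Data.Bool.Properties using (_≟_)
open import Data.List using (List; []; _∷_; _++_; [_])
open import Data.Vec using (Vec; []; _∷_)
open import Data.Sum using (_⊎_; inj₁; inj₂)
open import Data.Product using (_×_; _,_; ∃-syntax)
open import Relation.Nullary using (yes; no)
open import Relation.Nullary.Decidable using (does)
open import Relation.Binary.PropositionalEquality using (_≡_; refl; sym; cong)

m<[1+m/n]*n : ∀ m n .{{_ : NonZero n}} → m < suc (m / n) * n
m<[1+m/n]*n m n = begin-strict
  m                 ≡⟨ m≡m%n+[m/n]*n m n ⟩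
  m % n + m / n * n <⟨ +-monoˡ-< (m / n * n) (m%n<n m n) ⟩
  n + m / n * n     ∎
  where open ≤-Reasoning

[1+m/n]*n≤m+n : ∀ m n .{{_ : NonZero n}} → suc (m / n) * n ≤ m + n
[1+m/n]*n≤m+n m n = begin
  n + m / n * n ≤⟨ +-monoʳ-≤ n (m/n*n≤m m n) ⟩
  n + m         ≡⟨ +-comm n m ⟩
  m + n         ∎
  where open ≤-Reasoning

m*3≡m+m+m : ∀ m → m * 3 ≡ m + m + m
m*3≡m+m+m = solve-∀

mismatch-≡ : ∀ {s t} → s ≡ t → mismatch s t ≡ 0
mismatch-≡ {true} refl = refl
mismatch-≡ {false} refl = refl

mismatch≤1 : ∀ s t → mismatch s t ≤ 1
mismatch≤1 s t with does (s ≟ t)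
... | true = z≤n
... | false = ≤-refl

no-flip : ∀ s {t c u} → s ≡ t → c ≤ u → mismatch s t + c ≤ u
no-flip s s≡t c≤u rewrite mismatch-≡ s≡t = c≤u

one-flip : ∀ s t {c u} → c ≤ u → mismatch s t + c ≤ suc u
one-flip s t c≤u = +-mono-≤ (mismatch≤1 s t) c≤u

two-of-three-agree : (b₁ b₂ b₃ : Bool) → b₂ ≡ b₃ ⊎ b₁ ≡ b₃ ⊎ b₁ ≡ b₂
two-of-three-agree true  true  _     = inj₂ (inj₂ refl)
two-of-three-agree false false _     = inj₂ (inj₂ refl)
two-of-three-agree true  false true  = inj₂ (inj₁ refl)
two-of-three-agree true  false false = inj₁ refl
two-of-three-agree false true  true  = inj₁ refl
two-of-three-agree false true  false = inj₂ (inj₁ refl)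

TwoOf : Set → Set → Set → Set
TwoOf P Q R = (P × Q) ⊎ (P × R) ⊎ (Q × R)

TwoOf-map : ∀ {P Q R P′ Q′ R′ : Set} → (P → P′) → (Q → Q′) → (R → R′) →
            TwoOf P Q R → TwoOf P′ Q′ R′
TwoOf-map f g h (inj₁ (p , q))        = inj₁ (f p , g q)
TwoOf-map f g h (inj₂ (inj₁ (p , r))) = inj₂ (inj₁ (f p , h r))
TwoOf-map f g h (inj₂ (inj₂ (q , r))) = inj₂ (inj₂ (g q , h r))

-- Along a common received transcript every execution has the same histories hA and hB,
-- so Bob's bits are the same for all inputs and only Alice's bits can force flips.
module _ {X : Set} (aM : X → ℕ → List Bool → Bool) (bM : ℕ → List Bool → Bool) where

  both-within-budgets : ∀ y z {m} (o : Vec Party m) r hA hB u v → count alice o ≤ u + v →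
    ∃[ T ] (costFrom aM bM y r hA hB o T ≤ u × costFrom aM bM z r hA hB o T ≤ v)
  both-within-budgets y z [] r hA hB u v _ = [] , z≤n , z≤n
  both-within-budgets y z (bob ∷ o) r hA hB u v rounds≤
    with T , cy , cz ← both-within-budgets y z o (suc r) (hA ++ [ bM r hB ]) hB u v rounds≤
    = bM r hB ∷ T , no-flip (bM r hB) refl cy , no-flip (bM r hB) refl cz
  both-within-budgets y z (alice ∷ o) r hA hB u v rounds≤ with aM y r hA ≟ aM z r hA
  ... | yes y≡z
    with T , cy , cz ← both-within-budgets y z o (suc r) hA (hB ++ [ aM y r hA ]) u v (<⇒≤ rounds≤)
    = aM y r hA ∷ T , no-flip (aM y r hA) refl cy , no-flip (aM z r hA) (sym y≡z) cz
  both-within-budgets y z (alice ∷ o) r hA hB (suc u) v rounds≤ | no _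
    with T , cy , cz ← both-within-budgets y z o (suc r) hA (hB ++ [ aM z r hA ]) u v (≤-pred rounds≤)
    = aM z r hA ∷ T , one-flip (aM y r hA) (aM z r hA) cy , no-flip (aM z r hA) refl cz
  both-within-budgets y z (alice ∷ o) r hA hB zero (suc v) rounds≤ | no _
    with T , cy , cz ← both-within-budgets y z o (suc r) hA (hB ++ [ aM y r hA ]) zero v (≤-pred rounds≤)
    = aM y r hA ∷ T , no-flip (aM y r hA) refl cy , one-flip (aM z r hA) (aM y r hA) cz

  two-of-three-within-budgets : ∀ x₁ x₂ x₃ {m} (o : Vec Party m) r hA hB u₁ u₂ u₃ →
    count alice o ≤ u₁ + u₂ + u₃ →
    ∃[ T ] TwoOf (costFrom aM bM x₁ r hA hB o T ≤ u₁)
                 (costFrom aM bM x₂ r hA hB o T ≤ u₂)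
                 (costFrom aM bM x₃ r hA hB o T ≤ u₃)
  two-of-three-within-budgets x₁ x₂ x₃ o r hA hB zero u₂ u₃ rounds≤
    with T , c₂ , c₃ ← both-within-budgets x₂ x₃ o r hA hB u₂ u₃ rounds≤
    = T , inj₂ (inj₂ (c₂ , c₃))
  two-of-three-within-budgets x₁ x₂ x₃ o r hA hB u₁@(suc _) zero u₃ rounds≤
    with T , c₁ , c₃ ← both-within-budgets x₁ x₃ o r hA hB u₁ u₃
                         (≤-trans rounds≤ (≤-reflexive (cong (_+ u₃) (+-identityʳ u₁))))
    = T , inj₂ (inj₁ (c₁ , c₃))
  two-of-three-within-budgets x₁ x₂ x₃ o r hA hB u₁@(suc _) u₂@(suc _) zero rounds≤
    with T , c₁ , c₂ ← both-within-budgets x₁ x₂ o r hA hB u₁ u₂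
                         (≤-trans rounds≤ (≤-reflexive (+-identityʳ (u₁ + u₂))))
    = T , inj₁ (c₁ , c₂)
  two-of-three-within-budgets x₁ x₂ x₃ [] r hA hB (suc _) (suc _) (suc _) _ = [] , inj₁ (z≤n , z≤n)
  two-of-three-within-budgets x₁ x₂ x₃ (bob ∷ o) r hA hB u₁@(suc _) u₂@(suc _) u₃@(suc _) rounds≤
    with T , two ← two-of-three-within-budgets x₁ x₂ x₃ o (suc r) (hA ++ [ bM r hB ]) hB u₁ u₂ u₃ rounds≤
    = bM r hB ∷ T , TwoOf-map (no-flip (bM r hB) refl) (no-flip (bM r hB) refl)
                              (no-flip (bM r hB) refl) two
  two-of-three-within-budgets x₁ x₂ x₃ (alice ∷ o) r hA hB (suc u₁) (suc u₂) (suc u₃) rounds≤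
    with two-of-three-agree (aM x₁ r hA) (aM x₂ r hA) (aM x₃ r hA)
  ... | inj₁ b₂≡b₃
    with T , two ← two-of-three-within-budgets x₁ x₂ x₃ o (suc r) hA (hB ++ [ aM x₂ r hA ])
                     u₁ (suc u₂) (suc u₃) (≤-pred rounds≤)
    = aM x₂ r hA ∷ T , TwoOf-map (one-flip (aM x₁ r hA) (aM x₂ r hA))
                                 (no-flip (aM x₂ r hA) refl) (no-flip (aM x₃ r hA) (sym b₂≡b₃)) two
  ... | inj₂ (inj₁ b₁≡b₃)
    with T , two ← two-of-three-within-budgets x₁ x₂ x₃ o (suc r) hA (hB ++ [ aM x₁ r hA ])
                     (suc u₁) u₂ (suc u₃)
                     (≤-pred (≤-trans rounds≤ (≤-reflexive (cong (λ k → suc k + suc u₃) (+-suc u₁ u₂)))))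
    = aM x₁ r hA ∷ T , TwoOf-map (no-flip (aM x₁ r hA) refl) (one-flip (aM x₂ r hA) (aM x₁ r hA))
                                 (no-flip (aM x₃ r hA) (sym b₁≡b₃)) two
  ... | inj₂ (inj₂ b₁≡b₂)
    with T , two ← two-of-three-within-budgets x₁ x₂ x₃ o (suc r) hA (hB ++ [ aM x₁ r hA ])
                     (suc u₁) (suc u₂) u₃
                     (≤-pred (≤-trans rounds≤ (≤-reflexive (+-suc (suc u₁ + suc u₂) u₃))))
    = aM x₁ r hA ∷ T , TwoOf-map (no-flip (aM x₁ r hA) refl) (no-flip (aM x₂ r hA) (sym b₁≡b₂))
                                 (one-flip (aM x₃ r hA) (aM x₁ r hA)) two

lemma4p2 : (X : Set) (n : ℕ) (P : Protocol X n) (x₁ x₂ x₃ : X) →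
    CommonTranscript P x₁ x₂ ⊎ CommonTranscript P x₁ x₃ ⊎ CommonTranscript P x₂ x₃
lemma4p2 X n P x₁ x₂ x₃ =
  common (two-of-three-within-budgets (aliceMsg P) (bobMsg P) x₁ x₂ x₃ (order P) 0 [] [] K K K rounds≤)
  where
  A = bitsA P
  K = suc (A / 3)

  rounds≤ : A ≤ K + K + K
  rounds≤ = ≤-trans (<⇒≤ (m<[1+m/n]*n A 3)) (≤-reflexive (m*3≡m+m+m K))

  within : ∀ {c} → c ≤ K → 3 * c ≤ A + 3
  within c≤K = ≤-trans (*-monoʳ-≤ 3 c≤K) (≤-trans (≤-reflexive (*-comm 3 K)) ([1+m/n]*n≤m+n A 3))

  common : ∃[ T ] TwoOf (cost P x₁ T ≤ K) (cost P x₂ T ≤ K) (cost P x₃ T ≤ K) →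
           CommonTranscript P x₁ x₂ ⊎ CommonTranscript P x₁ x₃ ⊎ CommonTranscript P x₂ x₃
  common (T , inj₁ (c₁ , c₂))        = inj₁ (T , within c₁ , within c₂)
  common (T , inj₂ (inj₁ (c₁ , c₃))) = inj₂ (inj₁ (T , within c₁ , within c₃))
  common (T , inj₂ (inj₂ (c₂ , c₃))) = inj₂ (inj₂ (T , within c₂ , within c₃))
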